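{- Let $G=(V,E)$ be any labeled graph, let $\varepsilon>0$ be a sufficiently small constant, and let $V=V_{\mathrm{sparse}}\sqcup K_1\sqcup\cdots\sqcup K_k$ be an $\varepsilon$-sparse-dense decomposition of the $(+)$-subgraph $G^+$. Let $\mathcal{A}$ be the clustering in which every vertex $v\in V_{\mathrm{sparse}}$ forms its own singleton cluster $\{v\}$ and each $K_i$ forms one cluster. Then $\mathcal{A}$ is an $O(\varepsilon^{ -2})$-approximation for correlation clustering on $G$, i.e., its cost is at most $O(\varepsilon^{ -2})$ times the minimum cost of any clustering of $G$.
   Context: A labeled graph $G=(V,E)$ is a complete undirected graph in which every edge is labeled $+1$ or $-1$; $G^+$ is the subgraph of $(+)$-edges, and $N^+(v)$, $\deg^+(v)$ are neighborhood and degree in $G^+$. For a clustering (partition of $V$), an edge costs $1$ if it is a $(+)$-edge between different clusters or a $(-)$-edge inside a cluster, and $0$ otherwise; the cost of the clustering is the sum of edge costs, and correlation clustering asks to minimize it. For a graph $H$ with neighborhoods $N(\cdot)$ and degrees $\deg(\cdot)$, and $A\triangle B=(A\setminus B)\cup(B\setminus A)$, an $\varepsilon$-sparse-dense decomposition of $H$ is a partition $V=V_{\mathrm{sparse}}\sqcup K_1\sqcup\cdots\sqcup K_k$ such that, for an absolute constant $\eta_0>0$: (a) every $v\in V_{\mathrm{sparse}}$ has a set $S(v)\subseteq N(v)$ with $|S(v)|\ge \eta_0\varepsilon\deg(v)$ such that every $u\in S(v)$ satisfies $|N(u)\triangle N(v)|\ge \eta_0\varepsilon\max\{\deg(u),\deg(v)\}$;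 (b) for each $K_i$ (an "almost-clique"), letting $\Delta(K_i)=\max_{v\in K_i}\deg(v)$: $(1-\varepsilon)\Delta(K_i)\le |K_i|\le(1+\varepsilon)\Delta(K_i)$, every vertex of $K_i$ has at most $\varepsilon\Delta(K_i)$ non-neighbors inside $K_i$, and every vertex of $K_i$ has at most $\varepsilon\Delta(K_i)$ neighbors outside $K_i$. -}

module Defs where

open import Data.Nat as ℕ using (ℕ; _⊔_; _<ᵇ_; _≡ᵇ_)
open import Data.Integer using (+_)
open import Data.Rational using (ℚ; _/_; _*_; _≤_; 0ℚ)
open import Data.Bool using (Bool; true; false; if_then_else_; _∧_)
open import Data.Fin using (Fin; toℕ)
open import Data.Fin.Subset using (Subset; _∪_; _─_; ∣_∣; _⊆_; _∈_)
open import Data.Maybe using (Maybe; just; nothing)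
open import Data.List using (List; foldr; allFin; map)
open import Data.Nat.ListAction using (sum)
open import Data.Vec using (tabulate)
open import Data.Product using (Σ; _×_; ∃-syntax)
open import Relation.Binary.PropositionalEquality using (_≡_)

⟦_⟧ : ℕ → ℚ
⟦ m ⟧ = + m / 1

-- Following the standard convention for correlation clustering (Assadi–Wang),
-- every vertex carries a (+) self-loop, so N⁺(v) contains v.
record LabeledGraph (n : ℕ) : Set where
  field
    plus    : Fin n → Fin n → Bool
    plusSym : ∀ u v → plus u v ≡ plus v u
    plusRefl : ∀ v → plus v v ≡ true
open LabeledGraph public

module _ {n : ℕ} (G : LabeledGraph n) where

  N⁺ : Fin n → Subset n
  N⁺ v = tabulate (plus G v)

  deg⁺ : Fin n → ℕ
  deg⁺ v = ∣ N⁺ v ∣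

_△_ : {n : ℕ} → Subset n → Subset n → Subset n
A △ B = (A ─ B) ∪ (B ─ A)

-- A clustering is given by a cluster label for each vertex;
-- u and v are in the same cluster iff their labels are equal.
Clustering : ℕ → Set
Clustering n = Fin n → ℕ

edgeCost : {n : ℕ} → LabeledGraph n → Clustering n → Fin n → Fin n → ℕ
edgeCost G c u v with plus G u v | c u ≡ᵇ c v
... | true  | true  = 0
... | true  | false = 1
... | false | true  = 1
... | false | false = 0

cost : {n : ℕ} → LabeledGraph n → Clustering n → ℕ
cost {n} G c =
  sum (map (λ u → sum (map (λ v → if toℕ u <ᵇ toℕ v then edgeCost G c u v else 0)
                           (allFin n)))
           (allFin n))

-- A decomposition V = V_sparse ⊔ K_1 ⊔ ... ⊔ K_k is given by
-- part : Fin n → Maybe (Fin k): nothing = V_sparse, just i = K_i.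
module _ {n k : ℕ} (G : LabeledGraph n) (part : Fin n → Maybe (Fin k)) where

  inK : Fin k → Fin n → Bool
  inK i v with part v
  ... | nothing = false
  ... | just j  = toℕ i ≡ᵇ toℕ j

  Kset : Fin k → Subset n
  Kset i = tabulate (inK i)

  -- Δ(K_i) = max degree over vertices of K_i (0 if K_i is empty)
  Δ : Fin k → ℕ
  Δ i = foldr (λ v acc → if inK i v then deg⁺ G v ⊔ acc else acc) 0 (allFin n)

  record IsSparseDense (η₀ ε : ℚ) : Set where
    field
      sparseCond : ∀ v → part v ≡ nothing →
        Σ (Subset n) λ S →
          (S ⊆ N⁺ G v) ×
          (η₀ * ε * ⟦ deg⁺ G v ⟧ ≤ ⟦ ∣ S ∣ ⟧) ×
          (∀ u → u ∈ S →
             η₀ * ε * ⟦ deg⁺ G u ⊔ deg⁺ G v ⟧ ≤ ⟦ ∣ N⁺ G u △ N⁺ G v ∣ ⟧)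
      sizeLower : ∀ i → (⟦ 1 ⟧ Data.Rational.- ε) * ⟦ Δ i ⟧ ≤ ⟦ ∣ Kset i ∣ ⟧
      sizeUpper : ∀ i → ⟦ ∣ Kset i ∣ ⟧ ≤ (⟦ 1 ⟧ Data.Rational.+ ε) * ⟦ Δ i ⟧
      nonNbrsInside : ∀ i v → part v ≡ just i →
        ⟦ ∣ Kset i ─ N⁺ G v ∣ ⟧ ≤ ε * ⟦ Δ i ⟧
      nbrsOutside : ∀ i v → part v ≡ just i →
        ⟦ ∣ N⁺ G v ─ Kset i ∣ ⟧ ≤ ε * ⟦ Δ i ⟧

  clusteringA : Clustering n
  clusteringA v with part v
  ... | nothing = toℕ v
  ... | just i  = n ℕ.+ toℕ i

module Submission where

-- Fix a clustering c and let d(u) count the edges at u on which c disagrees with G, so that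
-- Σ d ≤ 2 cost(c). Every edge paid by 𝒜 is charged to a sparse endpoint, to c itself, or to an
-- endpoint u ∈ Kᵢ that is heavy, d(u) ≥ Δ(Kᵢ) / 4, which receives at most |Kᵢ △ N⁺(u)| ≤ 2εΔ ≤ 8 d(u).
-- If both endpoints are light, c decides the edge as 𝒜 does: separating two light vertices of Kᵢ
-- makes c pay at u or v for each of their at least (1 - 5ε)Δ common neighbours, and merging light
-- vertices of disjoint Kᵢ and Kⱼ makes it pay for N⁺(u) △ N⁺(v), which covers most of Kᵢ ∪ Kⱼ;
-- for ε ≤ 1/10 either way d(u) + d(v) ≥ Δ / 2, a contradiction. Finally a sparse vertex u has
-- η₀ε deg(u) neighbours v with |N⁺(u) △ N⁺(v)| ≥ η₀ε max(deg u, deg v): c separates u from v, or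
-- u or v pays an (η₀ε / 2)-fraction of its degree. Hence Σ over sparse u of deg(u) is O((η₀ε)⁻²) Σ d.

open import Defs

module Combinatorics where

  open import Algebra.Properties.Semiring.Sum as Sum using ()
  open import Data.Bool using (Bool; true; false; not; _∧_; _∨_; _xor_; if_then_else_; T)
  open import Data.Bool.Properties using (∧-zeroʳ; ∧-identityʳ; xor-identityʳ)
  open import Data.Empty using (⊥; ⊥-elim)
  open import Data.Fin using (Fin; zero; suc; toℕ)
  open import Data.Fin.Properties using (toℕ-injective; toℕ<n) renaming (_≟_ to _≟ᶠ_)
  open import Data.Fin.Subset using (Subset; inside; outside; _─_; _∩_; _∪_; _⊆_; _∈_; ∣_∣)
  open import Data.Fin.Subset.Properties using (∣p∣≤∣p∪q∣; p⊆q⇒∣p∣≤∣q∣)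
  open import Data.List as List using (allFin)
  open import Data.List.Properties using (map-tabulate)
  open import Data.Maybe using (Maybe; just; nothing; is-nothing)
  open import Data.Nat
  open import Data.Nat.Properties
  import Data.Nat.ListAction as ListAction
  open import Data.Nat.Tactic.RingSolver using (solve-∀)
  open import Data.Product using (Σ; _×_; _,_)
  open import Data.Vec using ([]; _∷_; lookup)
  open import Data.Vec.Properties using (lookup-zipWith; lookup∘tabulate; []=⇒lookup; lookup⇒[]=)
  open import Function using (_∘_; id)
  open import Relation.Binary.Definitions using (tri<; tri≈; tri>)
  open import Relation.Binary.PropositionalEquality hiding ([_])
  open import Relation.Nullary.Decidable using (yes; no; dec-true; dec-false)

  open Sum +-*-semiring using (sum; sum-syntax; sum-cong-≗; sum-replicate-zero; ∑-distrib-+; ∑-comm; *-distribˡ-sum)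

  -- Finite sums and subset sizes

  [_] : Bool → ℕ
  [ true ]  = 1
  [ false ] = 0

  sum-mono-≤ : ∀ {m} {f g : Fin m → ℕ} → (∀ x → f x ≤ g x) → sum f ≤ sum g
  sum-mono-≤ {zero}  f≤g = z≤n
  sum-mono-≤ {suc m} f≤g = +-mono-≤ (f≤g zero) (sum-mono-≤ (f≤g ∘ suc))

  sum-tabulate : ∀ {m} (f : Fin m → ℕ) → ListAction.sum (List.tabulate f) ≡ sum f
  sum-tabulate {zero}  f = refl
  sum-tabulate {suc m} f = cong (f zero +_) (sum-tabulate (f ∘ suc))

  sum-allFin : ∀ {m} (f : Fin m → ℕ) → ListAction.sum (List.map f (allFin m)) ≡ sum f
  sum-allFin f = trans (cong ListAction.sum (map-tabulate id f)) (sum-tabulate f)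

  ∣p∣≡∑ : ∀ {m} (p : Subset m) → ∣ p ∣ ≡ ∑[ x < m ] [ lookup p x ]
  ∣p∣≡∑ []            = refl
  ∣p∣≡∑ (inside  ∷ p) = cong suc (∣p∣≡∑ p)
  ∣p∣≡∑ (outside ∷ p) = ∣p∣≡∑ p

  module _ {m : ℕ} (p q : Subset m) (x : Fin m) where

    lookup-∩ : lookup (p ∩ q) x ≡ lookup p x ∧ lookup q x
    lookup-∩ = lookup-zipWith _∧_ x p q

    lookup-∪ : lookup (p ∪ q) x ≡ lookup p x ∨ lookup q x
    lookup-∪ = lookup-zipWith _∨_ x p q

    lookup-─ : lookup (p ─ q) x ≡ lookup p x ∧ not (lookup q x)
    lookup-─ with lookup q x | lookup-zipWith _ x p q
    ... | inside  | eq = trans eq (sym (∧-zeroʳ _))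
    ... | outside | eq = trans eq (sym (∧-identityʳ _))

  lookup-△ : ∀ {m} (p q : Subset m) x → lookup (p △ q) x ≡ lookup p x xor lookup q x
  lookup-△ p q x = begin
    lookup ((p ─ q) ∪ (q ─ p)) x                  ≡⟨ lookup-∪ (p ─ q) (q ─ p) x ⟩
    lookup (p ─ q) x ∨ lookup (q ─ p) x           ≡⟨ cong₂ _∨_ (lookup-─ p q x) (lookup-─ q p x) ⟩
    (a ∧ not b) ∨ (b ∧ not a)                     ≡⟨ difference-xor a b ⟩
    a xor b                                       ∎
    where
    open ≡-Reasoning
    a = lookup p x
    b = lookup q x
    difference-xor : ∀ a b → (a ∧ not b) ∨ (b ∧ not a) ≡ a xor b
    difference-xor true  true  = refl
    difference-xor true  false = refl
    difference-xor false true  = refl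
    difference-xor false false = refl

  ∣∣≤∑ : ∀ {m} (p : Subset m) {g : Fin m → ℕ} → (∀ x → [ lookup p x ] ≤ g x) → ∣ p ∣ ≤ sum g
  ∣∣≤∑ p p≤g = ≤-trans (≤-reflexive (∣p∣≡∑ p)) (sum-mono-≤ p≤g)

  ∑≡∣∣+∣∣ : ∀ {m} (p q : Subset m) → ∑[ x < m ] ([ lookup p x ] + [ lookup q x ]) ≡ ∣ p ∣ + ∣ q ∣
  ∑≡∣∣+∣∣ {m} p q = trans (∑-distrib-+ {m} (λ x → [ lookup p x ]) (λ x → [ lookup q x ]))
                          (sym (cong₂ _+_ (∣p∣≡∑ p) (∣p∣≡∑ q)))

  ∣p∪q∣≤∣p∣+∣q∣ : ∀ {m} (p q : Subset m) → ∣ p ∪ q ∣ ≤ ∣ p ∣ + ∣ q ∣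
  ∣p∪q∣≤∣p∣+∣q∣ p q = ≤-trans (∣∣≤∑ (p ∪ q) pointwise) (≤-reflexive (∑≡∣∣+∣∣ p q))
    where
    [∨]≤[]+[] : ∀ a b → [ a ∨ b ] ≤ [ a ] + [ b ]
    [∨]≤[]+[] true  b = s≤s z≤n
    [∨]≤[]+[] false b = ≤-refl
    pointwise : ∀ x → [ lookup (p ∪ q) x ] ≤ [ lookup p x ] + [ lookup q x ]
    pointwise x rewrite lookup-∪ p q x = [∨]≤[]+[] (lookup p x) (lookup q x)

  ∣K∣≤∣K─A∣+∣K─B∣+∣A∩B∣ : ∀ {m} (K A B : Subset m) → ∣ K ∣ ≤ ∣ K ─ A ∣ + ∣ K ─ B ∣ + ∣ A ∩ B ∣
  ∣K∣≤∣K─A∣+∣K─B∣+∣A∩B∣ {m} K A B = begin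
    ∣ K ∣                                                   ≤⟨ ∣∣≤∑ K pointwise ⟩
    ∑[ x < m ] ([ lookup (K ─ A) x ] + [ lookup (K ─ B) x ] + [ lookup (A ∩ B) x ])
                                                            ≡⟨ ∑-distrib-+ {m} _ _ ⟩
    ∑[ x < m ] ([ lookup (K ─ A) x ] + [ lookup (K ─ B) x ]) + ∑[ x < m ] [ lookup (A ∩ B) x ]
                                                            ≡⟨ cong₂ _+_ (∑≡∣∣+∣∣ (K ─ A) (K ─ B)) (sym (∣p∣≡∑ (A ∩ B))) ⟩
    ∣ K ─ A ∣ + ∣ K ─ B ∣ + ∣ A ∩ B ∣                       ∎
    where
    open ≤-Reasoning
    bound : ∀ k a b → [ k ] ≤ [ k ∧ not a ] + [ k ∧ not b ] + [ a ∧ b ]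
    bound false a     b     = z≤n
    bound true  false b     = s≤s z≤n
    bound true  true  false = s≤s z≤n
    bound true  true  true  = s≤s z≤n
    pointwise : ∀ x → [ lookup K x ] ≤ [ lookup (K ─ A) x ] + [ lookup (K ─ B) x ] + [ lookup (A ∩ B) x ]
    pointwise x rewrite lookup-─ K A x | lookup-─ K B x | lookup-∩ A B x = bound (lookup K x) (lookup A x) (lookup B x)

  ∣K∣+∣L∣≤∣K△A∣+∣L△B∣+∣A△B∣ : ∀ {m} (K L A B : Subset m) → (∀ x → lookup K x ∧ lookup L x ≡ false) →
    ∣ K ∣ + ∣ L ∣ ≤ ∣ K △ A ∣ + ∣ L △ B ∣ + ∣ A △ B ∣
  ∣K∣+∣L∣≤∣K△A∣+∣L△B∣+∣A△B∣ {m} K L A B disjoint = begin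
    ∣ K ∣ + ∣ L ∣                                           ≡⟨ ∑≡∣∣+∣∣ K L ⟨
    ∑[ x < m ] ([ lookup K x ] + [ lookup L x ])            ≤⟨ sum-mono-≤ pointwise ⟩
    ∑[ x < m ] ([ lookup (K △ A) x ] + [ lookup (L △ B) x ] + [ lookup (A △ B) x ])
                                                            ≡⟨ ∑-distrib-+ {m} _ _ ⟩
    ∑[ x < m ] ([ lookup (K △ A) x ] + [ lookup (L △ B) x ]) + ∑[ x < m ] [ lookup (A △ B) x ]
                                                            ≡⟨ cong₂ _+_ (∑≡∣∣+∣∣ (K △ A) (L △ B)) (sym (∣p∣≡∑ (A △ B))) ⟩
    ∣ K △ A ∣ + ∣ L △ B ∣ + ∣ A △ B ∣                       ∎
    where
    open ≤-Reasoning
    bound : ∀ k l a b → k ∧ l ≡ false → [ k ] + [ l ] ≤ [ k xor a ] + [ l xor b ] + [ a xor b ]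
    bound true  true  a     b     ()
    bound true  false false b     _ = s≤s z≤n
    bound true  false true  true  _ = s≤s z≤n
    bound true  false true  false _ = s≤s z≤n
    bound false true  false false _ = s≤s z≤n
    bound false true  true  false _ = s≤s z≤n
    bound false true  false true  _ = s≤s z≤n
    bound false true  true  true  _ = s≤s z≤n
    bound false false a     b     _ = z≤n
    pointwise : ∀ x → [ lookup K x ] + [ lookup L x ] ≤ [ lookup (K △ A) x ] + [ lookup (L △ B) x ] + [ lookup (A △ B) x ]
    pointwise x rewrite lookup-△ K A x | lookup-△ L B x | lookup-△ A B x =
      bound (lookup K x) (lookup L x) (lookup A x) (lookup B x) (disjoint x)

  ∑∑-symmetrise : ∀ {m} (F g : Fin m → Fin m → ℕ) →
    ∑[ u < m ] ∑[ v < m ] (F u v + F v u + g u v) ≡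
    ∑[ u < m ] ∑[ v < m ] F u v + ∑[ u < m ] ∑[ v < m ] F u v + ∑[ u < m ] ∑[ v < m ] g u v
  ∑∑-symmetrise {m} F g = begin
    ∑[ u < m ] ∑[ v < m ] (F u v + F v u + g u v)
      ≡⟨ sum-cong-≗ (λ u → trans (∑-distrib-+ (λ v → F u v + F v u) (g u))
                                 (cong (_+ ∑[ v < m ] g u v) (∑-distrib-+ (F u) (λ v → F v u)))) ⟩
    ∑[ u < m ] (∑[ v < m ] F u v + ∑[ v < m ] F v u + ∑[ v < m ] g u v)
      ≡⟨ trans (∑-distrib-+ (λ u → ∑[ v < m ] F u v + ∑[ v < m ] F v u) (λ u → ∑[ v < m ] g u v))
               (cong (_+ ∑[ u < m ] ∑[ v < m ] g u v) (∑-distrib-+ (λ u → ∑[ v < m ] F u v) (λ u → ∑[ v < m ] F v u))) ⟩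
    ∑[ u < m ] ∑[ v < m ] F u v + ∑[ u < m ] ∑[ v < m ] F v u + ∑[ u < m ] ∑[ v < m ] g u v
      ≡⟨ cong (λ t → ∑[ u < m ] ∑[ v < m ] F u v + t + ∑[ u < m ] ∑[ v < m ] g u v) (∑-comm (λ u v → F v u)) ⟩
    ∑[ u < m ] ∑[ v < m ] F u v + ∑[ u < m ] ∑[ v < m ] F u v + ∑[ u < m ] ∑[ v < m ] g u v ∎
    where open ≡-Reasoning

  ≡ᵇ-true : ∀ {m n} → m ≡ n → (m ≡ᵇ n) ≡ true
  ≡ᵇ-true {m} {n} = dec-true (m ≟ n)

  ≡ᵇ-false : ∀ {m n} → m ≢ n → (m ≡ᵇ n) ≡ false
  ≡ᵇ-false {m} {n} = dec-false (m ≟ n)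

  ≡ᵇ-sym : ∀ m n → (m ≡ᵇ n) ≡ (n ≡ᵇ m)
  ≡ᵇ-sym m n with m ≟ n
  ... | yes m≡n = trans (≡ᵇ-true m≡n) (sym (≡ᵇ-true (sym m≡n)))
  ... | no  m≢n = trans (≡ᵇ-false m≢n) (sym (≡ᵇ-false (m≢n ∘ sym)))

  -- The local cost of a clustering

  lookup-N⁺ : ∀ {n} (G : LabeledGraph n) u x → lookup (N⁺ G u) x ≡ plus G u x
  lookup-N⁺ G u = lookup∘tabulate (plus G u)

  module _ {n : ℕ} (G : LabeledGraph n) (c : Clustering n) where

    edgeCost≡ : ∀ u v → edgeCost G c u v ≡ [ plus G u v xor (c u ≡ᵇ c v) ]
    edgeCost≡ u v with plus G u v | c u ≡ᵇ c v
    ... | true  | true  = refl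
    ... | true  | false = refl
    ... | false | true  = refl
    ... | false | false = refl

    edgeCost-sym : ∀ u v → edgeCost G c u v ≡ edgeCost G c v u
    edgeCost-sym u v rewrite edgeCost≡ u v | edgeCost≡ v u | plusSym G u v | ≡ᵇ-sym (c u) (c v) = refl

    edgeCost-self : ∀ u → edgeCost G c u u ≡ 0
    edgeCost-self u rewrite edgeCost≡ u u | plusRefl G u | ≡ᵇ-true {c u} refl = refl

    localCost : Fin n → ℕ
    localCost u = ∑[ x < n ] edgeCost G c u x

    private
      orderedCost : Fin n → Fin n → ℕ
      orderedCost u v = if toℕ u <ᵇ toℕ v then edgeCost G c u v else 0

      cost≡∑∑ : cost G c ≡ ∑[ u < n ] ∑[ v < n ] orderedCost u v
      cost≡∑∑ = trans (sum-allFin {n} (λ u → ListAction.sum (List.map (orderedCost u) (allFin n))))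
                      (sum-cong-≗ (λ u → sum-allFin (orderedCost u)))

      orderedCost≤ : ∀ u v → orderedCost u v ≤ edgeCost G c u v
      orderedCost≤ u v with toℕ u <ᵇ toℕ v
      ... | true  = ≤-refl
      ... | false = z≤n

      ≤orderedCost+orderedCost : ∀ u v → edgeCost G c u v ≤ orderedCost u v + orderedCost v u
      ≤orderedCost+orderedCost u v with <-cmp (toℕ u) (toℕ v)
      ... | tri< u<v _ _ rewrite dec-true (toℕ u <? toℕ v) u<v = m≤m+n _ _
      ... | tri> _ _ v<u rewrite dec-true (toℕ v <? toℕ u) v<u = ≤-trans (≤-reflexive (edgeCost-sym u v)) (m≤n+m _ _)
      ... | tri≈ _ u≡v _ rewrite toℕ-injective u≡v | edgeCost-self v = z≤n

    cost≤∑localCost : cost G c ≤ ∑[ u < n ] localCost u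
    cost≤∑localCost = ≤-trans (≤-reflexive cost≡∑∑) (sum-mono-≤ λ u → sum-mono-≤ (orderedCost≤ u))

    ∑localCost≤2*cost : ∑[ u < n ] localCost u ≤ 2 * cost G c
    ∑localCost≤2*cost = begin
      ∑[ u < n ] ∑[ v < n ] edgeCost G c u v
        ≤⟨ sum-mono-≤ (λ u → sum-mono-≤ (≤orderedCost+orderedCost u)) ⟩
      ∑[ u < n ] ∑[ v < n ] (orderedCost u v + orderedCost v u)
        ≡⟨ sum-cong-≗ (λ u → ∑-distrib-+ (orderedCost u) (λ v → orderedCost v u)) ⟩
      ∑[ u < n ] (∑[ v < n ] orderedCost u v + ∑[ v < n ] orderedCost v u)
        ≡⟨ ∑-distrib-+ (λ u → ∑[ v < n ] orderedCost u v) (λ u → ∑[ v < n ] orderedCost v u) ⟩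
      ∑[ u < n ] ∑[ v < n ] orderedCost u v + ∑[ u < n ] ∑[ v < n ] orderedCost v u
        ≡⟨ cong (∑[ u < n ] ∑[ v < n ] orderedCost u v +_) (∑-comm (λ u v → orderedCost v u)) ⟩
      ∑[ u < n ] ∑[ v < n ] orderedCost u v + ∑[ v < n ] ∑[ u < n ] orderedCost v u
        ≡⟨ cong₂ _+_ cost≡∑∑ cost≡∑∑ ⟨
      cost G c + cost G c
        ≡⟨ cong (cost G c +_) (*-identityˡ (cost G c)) ⟨
      2 * cost G c ∎
      where open ≤-Reasoning

    ∣N⁺△N⁺∣≤localCost+localCost : ∀ {u v} → c u ≡ c v → ∣ N⁺ G u △ N⁺ G v ∣ ≤ localCost u + localCost v
    ∣N⁺△N⁺∣≤localCost+localCost {u} {v} cu≡cv =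
      ≤-trans (∣∣≤∑ (N⁺ G u △ N⁺ G v) pointwise) (≤-reflexive (∑-distrib-+ (edgeCost G c u) (edgeCost G c v)))
      where
      triangle : ∀ a b s → [ a xor b ] ≤ [ a xor s ] + [ b xor s ]
      triangle true  true  s     = z≤n
      triangle true  false true  = s≤s z≤n
      triangle true  false false = s≤s z≤n
      triangle false true  true  = s≤s z≤n
      triangle false true  false = s≤s z≤n
      triangle false false s     = z≤n
      pointwise : ∀ x → [ lookup (N⁺ G u △ N⁺ G v) x ] ≤ edgeCost G c u x + edgeCost G c v x
      pointwise x rewrite lookup-△ (N⁺ G u) (N⁺ G v) x | lookup-N⁺ G u x | lookup-N⁺ G v x
                        | edgeCost≡ u x | edgeCost≡ v x | cu≡cv = triangle (plus G u x) (plus G v x) (c v ≡ᵇ c x)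

    ∣N⁺∩N⁺∣≤localCost+localCost : ∀ {u v} → c u ≢ c v → ∣ N⁺ G u ∩ N⁺ G v ∣ ≤ localCost u + localCost v
    ∣N⁺∩N⁺∣≤localCost+localCost {u} {v} cu≢cv =
      ≤-trans (∣∣≤∑ (N⁺ G u ∩ N⁺ G v) pointwise) (≤-reflexive (∑-distrib-+ (edgeCost G c u) (edgeCost G c v)))
      where
      separated : ∀ a b s t → s ∧ t ≡ false → [ a ∧ b ] ≤ [ a xor s ] + [ b xor t ]
      separated true  true  true  true  ()
      separated true  true  true  false _ = s≤s z≤n
      separated true  true  false t     _ = s≤s z≤n
      separated true  false s     t     _ = z≤n
      separated false b     s     t     _ = z≤n
      not-both : ∀ x → (c u ≡ᵇ c x) ∧ (c v ≡ᵇ c x) ≡ false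
      not-both x with c u ≟ c x
      ... | yes cu≡cx rewrite ≡ᵇ-true cu≡cx = ≡ᵇ-false (λ cv≡cx → cu≢cv (trans cu≡cx (sym cv≡cx)))
      ... | no  cu≢cx rewrite ≡ᵇ-false cu≢cx = refl
      pointwise : ∀ x → [ lookup (N⁺ G u ∩ N⁺ G v) x ] ≤ edgeCost G c u x + edgeCost G c v x
      pointwise x rewrite lookup-∩ (N⁺ G u) (N⁺ G v) x | lookup-N⁺ G u x | lookup-N⁺ G v x
                        | edgeCost≡ u x | edgeCost≡ v x = separated (plus G u x) (plus G v x) _ _ (not-both x)

  -- Almost-cliques and light vertices

  -- Read with ε = e / f: (1 - 5ε) Δ ≤ s is impossible when ε ≤ 1/10 and s < Δ / 2.
  no-light-conflict : ∀ {e f Δ s} .{{_ : NonZero f}} → 10 * e ≤ f →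
    f * Δ ≤ 5 * (e * Δ) + f * s → 2 * s < Δ → ⊥
  no-light-conflict {e} {f} {Δ} {s} 10e≤f fΔ≤ 2s<Δ = <⇒≱ 2s<Δ (*-cancelˡ-≤ f (+-cancelˡ-≤ (f * Δ) _ _ (begin
    f * Δ + f * Δ               ≡⟨ double (f * Δ) ⟩
    2 * (f * Δ)                 ≤⟨ *-monoʳ-≤ 2 fΔ≤ ⟩
    2 * (5 * (e * Δ) + f * s)   ≡⟨ regroup e f Δ s ⟩
    (10 * e) * Δ + f * (2 * s)  ≤⟨ +-monoˡ-≤ (f * (2 * s)) (*-monoˡ-≤ Δ 10e≤f) ⟩
    f * Δ + f * (2 * s)         ∎)))
    where
    open ≤-Reasoning
    double : ∀ x → x + x ≡ 2 * x
    double = solve-∀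
    regroup : ∀ e f Δ s → 2 * (5 * (e * Δ) + f * s) ≡ (10 * e) * Δ + f * (2 * s)
    regroup = solve-∀

  -- With ε = e / f and d the local cost of c: Large K Δ says (1 - ε) Δ ≤ |K|,
  -- Close K Δ u says |K △ N⁺(u)| ≤ 2εΔ, and Light Δ u says d(u) < Δ / 4.
  module AlmostCliques {n : ℕ} (G : LabeledGraph n) (c : Clustering n) {e f : ℕ} .{{_ : NonZero f}} (10e≤f : 10 * e ≤ f) where

    Large : Subset n → ℕ → Set
    Large K Δ = f * Δ ≤ f * ∣ K ∣ + e * Δ

    Close : Subset n → ℕ → Fin n → Set
    Close K Δ u = f * ∣ K △ N⁺ G u ∣ ≤ 2 * (e * Δ)

    Light : ℕ → Fin n → Set
    Light Δ u = 4 * localCost G c u < Δ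

    close⇒∣K△N⁺∣≤2Δ : ∀ {K Δ u} → Close K Δ u → ∣ K △ N⁺ G u ∣ ≤ 2 * Δ
    close⇒∣K△N⁺∣≤2Δ {K} {Δ} {u} close = *-cancelˡ-≤ f (begin
      f * ∣ K △ N⁺ G u ∣   ≤⟨ close ⟩
      2 * (e * Δ)          ≤⟨ *-monoʳ-≤ 2 (*-monoˡ-≤ Δ (≤-trans (m≤n*m e 10) 10e≤f)) ⟩
      2 * (f * Δ)          ≡⟨ *-comm 2 (f * Δ) ⟩
      f * Δ * 2            ≡⟨ *-assoc f Δ 2 ⟩
      f * (Δ * 2)          ≡⟨ cong (f *_) (*-comm Δ 2) ⟩
      f * (2 * Δ)          ∎)
      where open ≤-Reasoning

    light-members-merged : ∀ {K Δ u v} → Large K Δ → Close K Δ u → Close K Δ v →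
      Light Δ u → Light Δ v → c u ≡ c v
    light-members-merged {K} {Δ} {u} {v} large close-u close-v light-u light-v with c u ≟ c v
    ... | yes cu≡cv = cu≡cv
    ... | no  cu≢cv = ⊥-elim (no-light-conflict {e} 10e≤f fΔ≤ 2s<Δ)
      where
      open ≤-Reasoning
      s = localCost G c u + localCost G c v
      a = ∣ K △ N⁺ G u ∣
      b = ∣ K △ N⁺ G v ∣
      ∣K∣≤ : ∣ K ∣ ≤ a + b + s
      ∣K∣≤ = begin
        ∣ K ∣                                           ≤⟨ ∣K∣≤∣K─A∣+∣K─B∣+∣A∩B∣ K (N⁺ G u) (N⁺ G v) ⟩
        ∣ K ─ N⁺ G u ∣ + ∣ K ─ N⁺ G v ∣ + ∣ N⁺ G u ∩ N⁺ G v ∣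
          ≤⟨ +-mono-≤ (+-mono-≤ (∣p∣≤∣p∪q∣ (K ─ N⁺ G u) (N⁺ G u ─ K)) (∣p∣≤∣p∪q∣ (K ─ N⁺ G v) (N⁺ G v ─ K)))
                      (∣N⁺∩N⁺∣≤localCost+localCost G c cu≢cv) ⟩
        a + b + s                                       ∎
      fΔ≤ : f * Δ ≤ 5 * (e * Δ) + f * s
      fΔ≤ = begin
        f * Δ                                  ≤⟨ large ⟩
        f * ∣ K ∣ + e * Δ                      ≤⟨ +-monoˡ-≤ (e * Δ) (*-monoʳ-≤ f ∣K∣≤) ⟩
        f * (a + b + s) + e * Δ                ≡⟨ distribute f a b s (e * Δ) ⟩
        f * a + f * b + f * s + e * Δ          ≤⟨ +-monoˡ-≤ (e * Δ) (+-monoˡ-≤ (f * s) (+-mono-≤ close-u close-v)) ⟩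
        2 * (e * Δ) + 2 * (e * Δ) + f * s + e * Δ ≡⟨ collect (e * Δ) (f * s) ⟩
        5 * (e * Δ) + f * s                    ∎
        where
        distribute : ∀ f a b s x → f * (a + b + s) + x ≡ f * a + f * b + f * s + x
        distribute = solve-∀
        collect : ∀ x y → 2 * x + 2 * x + y + x ≡ 5 * x + y
        collect = solve-∀
      2s<Δ : 2 * s < Δ
      2s<Δ = *-cancelˡ-< 2 _ _ (begin-strict
        2 * (2 * s)                                            ≡⟨ expand (localCost G c u) (localCost G c v) ⟩
        4 * localCost G c u + 4 * localCost G c v              <⟨ +-mono-< light-u light-v ⟩
        Δ + Δ                                                  ≡⟨ cong (Δ +_) (+-identityʳ Δ) ⟨
        2 * Δ                                                  ∎)
        where
        expand : ∀ x y → 2 * (2 * (x + y)) ≡ 4 * x + 4 * y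
        expand = solve-∀

    light-members-separated : ∀ {K L Δ Δ′ u v} → (∀ x → lookup K x ∧ lookup L x ≡ false) →
      Large K Δ → Large L Δ′ → Close K Δ u → Close L Δ′ v → Light Δ u → Light Δ′ v → c u ≢ c v
    light-members-separated {K} {L} {Δ} {Δ′} {u} {v} disjoint large-K large-L close-u close-v light-u light-v cu≡cv =
      no-light-conflict {e} 10e≤f fΔ≤ 2s<Δ
      where
      open ≤-Reasoning
      s = localCost G c u + localCost G c v
      a = ∣ K △ N⁺ G u ∣
      b = ∣ L △ N⁺ G v ∣
      ∣K∣+∣L∣≤ : ∣ K ∣ + ∣ L ∣ ≤ a + b + s
      ∣K∣+∣L∣≤ = ≤-trans (∣K∣+∣L∣≤∣K△A∣+∣L△B∣+∣A△B∣ K L (N⁺ G u) (N⁺ G v) disjoint)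
                         (+-monoʳ-≤ (a + b) (∣N⁺△N⁺∣≤localCost+localCost G c cu≡cv))
      fΔ≤ : f * (Δ + Δ′) ≤ 5 * (e * (Δ + Δ′)) + f * s
      fΔ≤ = begin
        f * (Δ + Δ′)                                 ≡⟨ *-distribˡ-+ f Δ Δ′ ⟩
        f * Δ + f * Δ′                               ≤⟨ +-mono-≤ large-K large-L ⟩
        f * ∣ K ∣ + e * Δ + (f * ∣ L ∣ + e * Δ′)     ≡⟨ regroup f e ∣ K ∣ ∣ L ∣ Δ Δ′ ⟩
        f * (∣ K ∣ + ∣ L ∣) + e * (Δ + Δ′)           ≤⟨ +-monoˡ-≤ (e * (Δ + Δ′)) (*-monoʳ-≤ f ∣K∣+∣L∣≤) ⟩
        f * (a + b + s) + e * (Δ + Δ′)               ≡⟨ distribute f a b s (e * (Δ + Δ′)) ⟩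
        f * a + f * b + f * s + e * (Δ + Δ′)         ≤⟨ +-monoˡ-≤ (e * (Δ + Δ′)) (+-monoˡ-≤ (f * s) (+-mono-≤ close-u close-v)) ⟩
        2 * (e * Δ) + 2 * (e * Δ′) + f * s + e * (Δ + Δ′) ≡⟨ collect e Δ Δ′ (f * s) ⟩
        3 * (e * (Δ + Δ′)) + f * s                   ≤⟨ +-monoˡ-≤ (f * s) (*-monoˡ-≤ (e * (Δ + Δ′)) (m≤m+n 3 2)) ⟩
        5 * (e * (Δ + Δ′)) + f * s                   ∎
        where
        regroup : ∀ f e k l Δ Δ′ → f * k + e * Δ + (f * l + e * Δ′) ≡ f * (k + l) + e * (Δ + Δ′)
        regroup = solve-∀
        distribute : ∀ f a b s x → f * (a + b + s) + x ≡ f * a + f * b + f * s + x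
        distribute = solve-∀
        collect : ∀ e Δ Δ′ y → 2 * (e * Δ) + 2 * (e * Δ′) + y + e * (Δ + Δ′) ≡ 3 * (e * (Δ + Δ′)) + y
        collect = solve-∀
      2s<Δ : 2 * s < Δ + Δ′
      2s<Δ = begin-strict
        2 * s                                       ≤⟨ *-monoˡ-≤ s (m≤m+n 2 2) ⟩
        4 * s                                       ≡⟨ *-distribˡ-+ 4 (localCost G c u) (localCost G c v) ⟩
        4 * localCost G c u + 4 * localCost G c v   <⟨ +-mono-< light-u light-v ⟩
        Δ + Δ′                                      ∎

  -- Sparse vertices

  [∧]≡[]*[] : ∀ a b → [ a ∧ b ] ≡ [ a ] * [ b ]
  [∧]≡[]*[] true  true  = refl
  [∧]≡[]*[] true  false = refl
  [∧]≡[]*[] false b     = refl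

  deg⁺≡∑ : ∀ {n} (G : LabeledGraph n) u → deg⁺ G u ≡ ∑[ x < n ] [ plus G u x ]
  deg⁺≡∑ G u = trans (∣p∣≡∑ (N⁺ G u)) (sum-cong-≗ (λ x → cong [_] (lookup-N⁺ G u x)))

  ≤ᵇ-false : ∀ {m n} → (m ≤ᵇ n) ≡ false → n < m
  ≤ᵇ-false m≰ᵇn = ≰⇒> (λ m≤n → subst T m≰ᵇn (≤⇒≤ᵇ m≤n))

  no-cheap-pair : ∀ P Q x y a b → P * (x ⊔ y) ≤ Q * (a + b) → Q * (2 * a) < P * x → Q * (2 * b) < P * y → ⊥
  no-cheap-pair P Q x y a b bound a-cheap b-cheap = <-irrefl refl (begin-strict
    Q * (2 * a) + Q * (2 * b)   <⟨ +-mono-< a-cheap b-cheap ⟩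
    P * x + P * y               ≤⟨ +-mono-≤ (*-monoʳ-≤ P (m≤m⊔n x y)) (*-monoʳ-≤ P (m≤n⊔m x y)) ⟩
    P * (x ⊔ y) + P * (x ⊔ y)   ≤⟨ +-mono-≤ bound bound ⟩
    Q * (a + b) + Q * (a + b)   ≡⟨ split Q a b ⟩
    Q * (2 * a) + Q * (2 * b)   ∎)
    where
    open ≤-Reasoning
    split : ∀ Q a b → Q * (a + b) + Q * (a + b) ≡ Q * (2 * a) + Q * (2 * b)
    split = solve-∀

  module SparseVertices {n : ℕ} (G : LabeledGraph n) (c : Clustering n) (P Q : ℕ) where

    expensive : Fin n → Bool
    expensive u = P * deg⁺ G u ≤ᵇ Q * (2 * localCost G c u)

    expensiveDegree : Fin n → ℕ
    expensiveDegree u = [ expensive u ] * deg⁺ G u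

    sparseWeight : Fin n → ℕ
    sparseWeight u = localCost G c u + expensiveDegree u + ∑[ x < n ] [ expensive x ∧ plus G u x ]

    sparse-vertex-bound : ∀ {u} (S : Subset n) → S ⊆ N⁺ G u → P * deg⁺ G u ≤ Q * ∣ S ∣ →
      (∀ v → v ∈ S → P * (deg⁺ G v ⊔ deg⁺ G u) ≤ Q * ∣ N⁺ G v △ N⁺ G u ∣) →
      P * deg⁺ G u ≤ Q * sparseWeight u
    sparse-vertex-bound {u} S S⊆N⁺ degree-bound dissimilar = ≤-trans degree-bound (*-monoʳ-≤ Q (begin
      ∣ S ∣
        ≤⟨ ∣∣≤∑ S pointwise ⟩
      ∑[ x < n ] (edgeCost G c u x + [ expensive u ] * [ lookup S x ] + [ expensive x ∧ plus G u x ])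
        ≡⟨ ∑-distrib-+ (λ x → edgeCost G c u x + [ expensive u ] * [ lookup S x ]) (λ x → [ expensive x ∧ plus G u x ]) ⟩
      ∑[ x < n ] (edgeCost G c u x + [ expensive u ] * [ lookup S x ]) + ∑[ x < n ] [ expensive x ∧ plus G u x ]
        ≡⟨ cong (_+ ∑[ x < n ] [ expensive x ∧ plus G u x ]) (∑-distrib-+ (edgeCost G c u) (λ x → [ expensive u ] * [ lookup S x ])) ⟩
      localCost G c u + ∑[ x < n ] ([ expensive u ] * [ lookup S x ]) + ∑[ x < n ] [ expensive x ∧ plus G u x ]
        ≡⟨ cong (λ t → localCost G c u + t + ∑[ x < n ] [ expensive x ∧ plus G u x ])
                (trans (cong ([ expensive u ] *_) (∣p∣≡∑ S)) (*-distribˡ-sum [ expensive u ] (λ x → [ lookup S x ]))) ⟨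
      localCost G c u + [ expensive u ] * ∣ S ∣ + ∑[ x < n ] [ expensive x ∧ plus G u x ]
        ≤⟨ +-monoˡ-≤ _ (+-monoʳ-≤ (localCost G c u) (*-monoʳ-≤ [ expensive u ] (p⊆q⇒∣p∣≤∣q∣ S⊆N⁺))) ⟩
      sparseWeight u ∎))
      where
      open ≤-Reasoning
      neighbour : ∀ {x} → lookup S x ≡ true → plus G u x ≡ true
      neighbour {x} x∈S = trans (sym (lookup-N⁺ G u x)) ([]=⇒lookup (S⊆N⁺ (lookup⇒[]= x S x∈S)))
      separated : ∀ {x} → lookup S x ≡ true → expensive u ≡ false → expensive x ≡ false → c u ≢ c x
      separated {x} x∈S u-cheap x-cheap cu≡cx =
        no-cheap-pair P Q (deg⁺ G x) (deg⁺ G u) (localCost G c x) (localCost G c u)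
          (≤-trans (dissimilar x (lookup⇒[]= x S x∈S))
                   (*-monoʳ-≤ Q (∣N⁺△N⁺∣≤localCost+localCost G c (sym cu≡cx))))
          (≤ᵇ-false x-cheap) (≤ᵇ-false u-cheap)
      bound : ∀ s p eu ex same → (s ≡ true → p ≡ true) → (s ≡ true → eu ≡ false → ex ≡ false → same ≡ false) →
        [ s ] ≤ [ p xor same ] + [ eu ] * [ s ] + [ ex ∧ p ]
      bound false p  eu    ex    same  _ _ = z≤n
      bound true  p  true  ex    same  _ _ = ≤-trans (m≤n+m 1 [ p xor same ]) (m≤m+n _ [ ex ∧ p ])
      bound true  p  false true  same  s⇒p _ rewrite s⇒p refl = m≤n+m 1 _
      bound true  p  false false same  s⇒p sep rewrite s⇒p refl | sep refl refl refl = s≤s z≤n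
      pointwise : ∀ x → [ lookup S x ] ≤ edgeCost G c u x + [ expensive u ] * [ lookup S x ] + [ expensive x ∧ plus G u x ]
      pointwise x rewrite edgeCost≡ G c u x =
        bound (lookup S x) (plus G u x) (expensive u) (expensive x) (c u ≡ᵇ c x) neighbour
              (λ x∈S u-cheap x-cheap → ≡ᵇ-false (separated x∈S u-cheap x-cheap))

    ∑expensive-neighbours≡ : ∑[ u < n ] ∑[ x < n ] [ expensive x ∧ plus G u x ] ≡ ∑[ x < n ] expensiveDegree x
    ∑expensive-neighbours≡ = trans (∑-comm (λ u x → [ expensive x ∧ plus G u x ])) (sum-cong-≗ column)
      where
      column : ∀ x → ∑[ u < n ] [ expensive x ∧ plus G u x ] ≡ expensiveDegree x
      column x = begin
        ∑[ u < n ] [ expensive x ∧ plus G u x ]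
          ≡⟨ sum-cong-≗ (λ u → trans (cong (λ b → [ expensive x ∧ b ]) (plusSym G u x)) ([∧]≡[]*[] (expensive x) (plus G x u))) ⟩
        ∑[ u < n ] ([ expensive x ] * [ plus G x u ])    ≡⟨ *-distribˡ-sum [ expensive x ] (λ u → [ plus G x u ]) ⟨
        [ expensive x ] * ∑[ u < n ] [ plus G x u ]      ≡⟨ cong ([ expensive x ] *_) (deg⁺≡∑ G x) ⟨
        expensiveDegree x                                ∎
        where open ≡-Reasoning

    P*∑expensiveDegree≤ : P * ∑[ u < n ] expensiveDegree u ≤ Q * (2 * ∑[ u < n ] localCost G c u)
    P*∑expensiveDegree≤ = begin
      P * ∑[ u < n ] expensiveDegree u             ≡⟨ *-distribˡ-sum P expensiveDegree ⟩
      ∑[ u < n ] (P * expensiveDegree u)           ≤⟨ sum-mono-≤ pointwise ⟩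
      ∑[ u < n ] (Q * (2 * localCost G c u))       ≡⟨ *-distribˡ-sum Q (λ u → 2 * localCost G c u) ⟨
      Q * ∑[ u < n ] (2 * localCost G c u)         ≡⟨ cong (Q *_) (*-distribˡ-sum 2 (localCost G c)) ⟨
      Q * (2 * ∑[ u < n ] localCost G c u)         ∎
      where
      open ≤-Reasoning
      pointwise : ∀ u → P * expensiveDegree u ≤ Q * (2 * localCost G c u)
      pointwise u with expensive u in eu
      ... | true  = ≤-trans (≤-reflexive (cong (P *_) (+-identityʳ (deg⁺ G u)))) (≤ᵇ⇒≤ _ _ (subst T (sym eu) _))
      ... | false = ≤-trans (≤-reflexive (*-zeroʳ P)) z≤n

    sparse-degrees-bound : (w : Fin n → ℕ) → (∀ u → P * w u ≤ Q * sparseWeight u) →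
      P * P * ∑[ u < n ] w u ≤ Q * (P + 4 * Q) * ∑[ u < n ] localCost G c u
    sparse-degrees-bound w w-bound = begin
      P * P * ∑[ u < n ] w u                    ≡⟨ *-assoc P P _ ⟩
      P * (P * ∑[ u < n ] w u)                  ≡⟨ cong (P *_) (*-distribˡ-sum P w) ⟩
      P * ∑[ u < n ] (P * w u)                  ≤⟨ *-monoʳ-≤ P (sum-mono-≤ w-bound) ⟩
      P * ∑[ u < n ] (Q * sparseWeight u)       ≡⟨ cong (P *_) (*-distribˡ-sum Q sparseWeight) ⟨
      P * (Q * ∑[ u < n ] sparseWeight u)       ≡⟨ cong (λ t → P * (Q * t)) ∑sparseWeight≡ ⟩
      P * (Q * (D + E + E))                     ≡⟨ expand P Q D E ⟩
      Q * (P * D + P * E + P * E)               ≤⟨ *-monoʳ-≤ Q (+-mono-≤ (+-monoʳ-≤ (P * D) P*∑expensiveDegree≤) P*∑expensiveDegree≤) ⟩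
      Q * (P * D + Q * (2 * D) + Q * (2 * D))   ≡⟨ collect P Q D ⟩
      Q * (P + 4 * Q) * D                       ∎
      where
      open ≤-Reasoning
      D = ∑[ u < n ] localCost G c u
      E = ∑[ u < n ] expensiveDegree u
      ∑sparseWeight≡ : ∑[ u < n ] sparseWeight u ≡ D + E + E
      ∑sparseWeight≡ = trans (∑-distrib-+ (λ u → localCost G c u + expensiveDegree u) (λ u → ∑[ x < n ] [ expensive x ∧ plus G u x ]))
                             (cong₂ _+_ (∑-distrib-+ (localCost G c) expensiveDegree) ∑expensive-neighbours≡)
      expand : ∀ P Q D E → P * (Q * (D + E + E)) ≡ Q * (P * D + P * E + P * E)
      expand = solve-∀
      collect : ∀ P Q D → Q * (P * D + Q * (2 * D) + Q * (2 * D)) ≡ Q * (P + 4 * Q) * D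
      collect = solve-∀

  -- Charging the cost of 𝒜

  +-≡ᵇ : ∀ m a b → (m + a ≡ᵇ m + b) ≡ (a ≡ᵇ b)
  +-≡ᵇ zero    a b = refl
  +-≡ᵇ (suc m) a b = +-≡ᵇ m a b

  module Decomposition {n k : ℕ} (G : LabeledGraph n) (part : Fin n → Maybe (Fin k)) where

    lookup-Kset : ∀ i x → lookup (Kset G part i) x ≡ inK G part i x
    lookup-Kset i = lookup∘tabulate (inK G part i)

    inK-just : ∀ {i j x} → part x ≡ just j → inK G part i x ≡ (toℕ i ≡ᵇ toℕ j)
    inK-just {i} {j} {x} px with part x
    inK-just refl | just _ = refl

    Kset-disjoint : ∀ {i j} → i ≢ j → ∀ x → lookup (Kset G part i) x ∧ lookup (Kset G part j) x ≡ false
    Kset-disjoint {i} {j} i≢j x rewrite lookup-Kset i x | lookup-Kset j x with part x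
    ... | nothing = refl
    ... | just l with toℕ i ≟ toℕ l
    ...   | yes i≡l rewrite ≡ᵇ-true i≡l = ≡ᵇ-false (λ j≡l → i≢j (toℕ-injective (trans i≡l (sym j≡l))))
    ...   | no  i≢l rewrite ≡ᵇ-false i≢l = refl

    clusteringA-nothing : ∀ {u} → part u ≡ nothing → clusteringA G part u ≡ toℕ u
    clusteringA-nothing {u} pu with part u
    clusteringA-nothing refl | nothing = refl

    clusteringA-just : ∀ {u i} → part u ≡ just i → clusteringA G part u ≡ n + toℕ i
    clusteringA-just {u} pu with part u
    clusteringA-just refl | just _ = refl

    clusteringA-singleton : ∀ {u v} → part u ≡ nothing → clusteringA G part u ≡ clusteringA G part v → u ≡ v
    clusteringA-singleton {u} {v} pu Au≡Av = by-part-of-v (part v) refl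
      where
      by-part-of-v : ∀ o → part v ≡ o → u ≡ v
      by-part-of-v nothing  pv = toℕ-injective (trans (sym (clusteringA-nothing pu)) (trans Au≡Av (clusteringA-nothing pv)))
      by-part-of-v (just j) pv = ⊥-elim (<⇒≱ (toℕ<n u) (≤-trans (m≤m+n n (toℕ j))
        (≤-reflexive (trans (sym (clusteringA-just pv)) (trans (sym Au≡Av) (clusteringA-nothing pu))))))

    clusteringA-dense : ∀ {u v i j} → part u ≡ just i → part v ≡ just j →
      (clusteringA G part u ≡ᵇ clusteringA G part v) ≡ (toℕ i ≡ᵇ toℕ j)
    clusteringA-dense {i = i} {j} pu pv rewrite clusteringA-just pu | clusteringA-just pv = +-≡ᵇ n (toℕ i) (toℕ j)

    singleton-edgeCost : ∀ {u} v → part u ≡ nothing → edgeCost G (clusteringA G part) u v ≤ [ plus G u v ]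
    singleton-edgeCost {u} v pu with clusteringA G part u ≟ clusteringA G part v
    ... | no Au≢Av rewrite edgeCost≡ G (clusteringA G part) u v | ≡ᵇ-false Au≢Av | xor-identityʳ (plus G u v) = ≤-refl
    ... | yes Au≡Av with clusteringA-singleton pu Au≡Av
    ...   | refl rewrite edgeCost-self G (clusteringA G part) u = z≤n

  module Charging {n k : ℕ} (G : LabeledGraph n) (part : Fin n → Maybe (Fin k)) (c : Clustering n)
    {e f : ℕ} .{{_ : NonZero f}} (10e≤f : 10 * e ≤ f)
    (large : ∀ i → f * Δ G part i ≤ f * ∣ Kset G part i ∣ + e * Δ G part i)
    (close : ∀ {i u} → part u ≡ just i → f * ∣ Kset G part i △ N⁺ G u ∣ ≤ 2 * (e * Δ G part i)) where

    open Decomposition G part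
    open AlmostCliques G c {e} 10e≤f

    heavy : Fin k → Fin n → Bool
    heavy i u = Δ G part i ≤ᵇ 4 * localCost G c u

    sparseCharge : Fin n → Fin n → ℕ
    sparseCharge u v = [ is-nothing (part u) ∧ plus G u v ]

    denseCharge : Maybe (Fin k) → Fin n → Fin n → ℕ
    denseCharge nothing  u v = 0
    denseCharge (just i) u v = [ heavy i u ∧ (inK G part i v xor plus G u v) ]

    oneSidedCharge : Fin n → Fin n → ℕ
    oneSidedCharge u v = sparseCharge u v + denseCharge (part u) u v

    light-pair : ∀ {u v i j} → part u ≡ just i → part v ≡ just j → heavy i u ≡ false → heavy j v ≡ false →
      (c u ≡ᵇ c v) ≡ (toℕ i ≡ᵇ toℕ j)
    light-pair {u} {v} {i} {j} pu pv u-light v-light with i ≟ᶠ j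
    ... | yes refl = trans (≡ᵇ-true (light-members-merged {Kset G part i}
                                        (large i) (close pu) (close pv) (≤ᵇ-false u-light) (≤ᵇ-false v-light)))
                           (sym (≡ᵇ-true {toℕ i} refl))
    ... | no  i≢j  = trans (≡ᵇ-false (light-members-separated {Kset G part i} {Kset G part j} (Kset-disjoint i≢j)
                                        (large i) (large j) (close pu) (close pv) (≤ᵇ-false u-light) (≤ᵇ-false v-light)))
                           (sym (≡ᵇ-false (i≢j ∘ toℕ-injective)))

    denseCharge-pair : ∀ {u v i j} → part u ≡ just i → part v ≡ just j →
      denseCharge (part u) u v ≡ [ heavy i u ∧ ((toℕ i ≡ᵇ toℕ j) xor plus G u v) ]
    denseCharge-pair {u} {v} {i} pu pv =
      trans (cong (λ o → denseCharge o u v) pu) (cong (λ b → [ heavy i u ∧ (b xor plus G u v) ]) (inK-just pv))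

    dense-edgeCost : ∀ {u v i j} → part u ≡ just i → part v ≡ just j →
      edgeCost G (clusteringA G part) u v ≤ denseCharge (part u) u v + denseCharge (part v) v u + edgeCost G c u v
    dense-edgeCost {u} {v} {i} {j} pu pv = begin
      edgeCost G (clusteringA G part) u v
        ≡⟨ trans (edgeCost≡ G (clusteringA G part) u v) (cong (λ s → [ plus G u v xor s ]) (clusteringA-dense pu pv)) ⟩
      [ plus G u v xor b ]
        ≤⟨ bound (plus G u v) b (c u ≡ᵇ c v) (heavy i u) (heavy j v) (light-pair pu pv) ⟩
      [ heavy i u ∧ (b xor plus G u v) ] + [ heavy j v ∧ (b xor plus G u v) ] + [ plus G u v xor (c u ≡ᵇ c v) ]
        ≡⟨ cong₃ (λ x y z → x + y + z) (denseCharge-pair pu pv) v-side (edgeCost≡ G c u v) ⟨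
      denseCharge (part u) u v + denseCharge (part v) v u + edgeCost G c u v ∎
      where
      open ≤-Reasoning
      b = toℕ i ≡ᵇ toℕ j
      cong₃ : ∀ {x x′ y y′ z z′} (g : ℕ → ℕ → ℕ → ℕ) → x ≡ x′ → y ≡ y′ → z ≡ z′ → g x y z ≡ g x′ y′ z′
      cong₃ g refl refl refl = refl
      v-side : denseCharge (part v) v u ≡ [ heavy j v ∧ (b xor plus G u v) ]
      v-side = trans (denseCharge-pair pv pu)
        (cong₂ (λ b′ p → [ heavy j v ∧ (b′ xor p) ]) (≡ᵇ-sym (toℕ j) (toℕ i)) (plusSym G v u))
      bound : ∀ p b s h₁ h₂ → (h₁ ≡ false → h₂ ≡ false → s ≡ b) →
        [ p xor b ] ≤ [ h₁ ∧ (b xor p) ] + [ h₂ ∧ (b xor p) ] + [ p xor s ]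
      bound true  true  s h₁    h₂    _     = z≤n
      bound false false s h₁    h₂    _     = z≤n
      bound true  false s true  h₂    _     = s≤s z≤n
      bound true  false s false true  _     = s≤s z≤n
      bound true  false s false false light rewrite light refl refl = s≤s z≤n
      bound false true  s true  h₂    _     = s≤s z≤n
      bound false true  s false true  _     = s≤s z≤n
      bound false true  s false false light rewrite light refl refl = s≤s z≤n

    charge : Fin n → Fin n → ℕ
    charge u v = oneSidedCharge u v + oneSidedCharge v u + edgeCost G c u v

    edgeCost-A≤charge : ∀ u v → edgeCost G (clusteringA G part) u v ≤ charge u v
    edgeCost-A≤charge u v = by-parts (part u) (part v) refl refl
      where
      open ≤-Reasoning
      by-parts : ∀ o o′ → part u ≡ o → part v ≡ o′ → edgeCost G (clusteringA G part) u v ≤ charge u v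
      by-parts nothing _ pu _ = begin
        edgeCost G (clusteringA G part) u v    ≤⟨ singleton-edgeCost v pu ⟩
        [ plus G u v ]                         ≡⟨ cong (λ o → [ is-nothing o ∧ plus G u v ]) pu ⟨
        sparseCharge u v                       ≤⟨ m≤m+n _ _ ⟩
        oneSidedCharge u v                     ≤⟨ ≤-trans (m≤m+n _ _) (m≤m+n _ _) ⟩
        charge u v                             ∎
      by-parts (just i) nothing _ pv = begin
        edgeCost G (clusteringA G part) u v    ≡⟨ edgeCost-sym G (clusteringA G part) u v ⟩
        edgeCost G (clusteringA G part) v u    ≤⟨ singleton-edgeCost u pv ⟩
        [ plus G v u ]                         ≡⟨ cong (λ o → [ is-nothing o ∧ plus G v u ]) pv ⟨
        sparseCharge v u                       ≤⟨ m≤m+n _ _ ⟩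
        oneSidedCharge v u                     ≤⟨ ≤-trans (m≤n+m _ (oneSidedCharge u v)) (m≤m+n _ _) ⟩
        charge u v                             ∎
      by-parts (just i) (just j) pu pv = ≤-trans (dense-edgeCost pu pv)
        (+-monoˡ-≤ (edgeCost G c u v) (+-mono-≤ (m≤n+m _ (sparseCharge u v)) (m≤n+m _ (sparseCharge v u))))

    sparseDegree : Fin n → ℕ
    sparseDegree u = [ is-nothing (part u) ] * deg⁺ G u

    ∑sparseCharge≡ : ∀ u → ∑[ v < n ] sparseCharge u v ≡ sparseDegree u
    ∑sparseCharge≡ u = begin
      ∑[ v < n ] [ is-nothing (part u) ∧ plus G u v ]       ≡⟨ sum-cong-≗ (λ v → [∧]≡[]*[] (is-nothing (part u)) (plus G u v)) ⟩
      ∑[ v < n ] ([ is-nothing (part u) ] * [ plus G u v ]) ≡⟨ *-distribˡ-sum [ is-nothing (part u) ] (λ v → [ plus G u v ]) ⟨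
      [ is-nothing (part u) ] * ∑[ v < n ] [ plus G u v ]   ≡⟨ cong ([ is-nothing (part u) ] *_) (deg⁺≡∑ G u) ⟨
      sparseDegree u                                        ∎
      where open ≡-Reasoning

    ∑denseCharge≤ : ∀ u → ∑[ v < n ] denseCharge (part u) u v ≤ 8 * localCost G c u
    ∑denseCharge≤ u = by-part (part u) refl
      where
      open ≤-Reasoning
      by-part : ∀ o → part u ≡ o → ∑[ v < n ] denseCharge o u v ≤ 8 * localCost G c u
      by-part nothing  _  = subst (_≤ 8 * localCost G c u) (sym (sum-replicate-zero n)) z≤n
      by-part (just i) pu = begin
        ∑[ v < n ] [ heavy i u ∧ (inK G part i v xor plus G u v) ]
          ≡⟨ sum-cong-≗ (λ v → [∧]≡[]*[] (heavy i u) (inK G part i v xor plus G u v)) ⟩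
        ∑[ v < n ] ([ heavy i u ] * [ inK G part i v xor plus G u v ])
          ≡⟨ *-distribˡ-sum [ heavy i u ] (λ v → [ inK G part i v xor plus G u v ]) ⟨
        [ heavy i u ] * ∑[ v < n ] [ inK G part i v xor plus G u v ]
          ≡⟨ cong ([ heavy i u ] *_) (trans (∣p∣≡∑ (Kset G part i △ N⁺ G u))
                  (sum-cong-≗ λ v → cong [_] (trans (lookup-△ (Kset G part i) (N⁺ G u) v)
                                                    (cong₂ _xor_ (lookup-Kset i v) (lookup-N⁺ G u v))))) ⟨
        [ heavy i u ] * ∣ Kset G part i △ N⁺ G u ∣
          ≤⟨ heavy-bound (heavy i u) refl ⟩
        8 * localCost G c u ∎
        where
        heavy-bound : ∀ h → heavy i u ≡ h → [ h ] * ∣ Kset G part i △ N⁺ G u ∣ ≤ 8 * localCost G c u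
        heavy-bound false _ = z≤n
        heavy-bound true  h = begin
          1 * ∣ Kset G part i △ N⁺ G u ∣   ≡⟨ *-identityˡ _ ⟩
          ∣ Kset G part i △ N⁺ G u ∣       ≤⟨ close⇒∣K△N⁺∣≤2Δ {Kset G part i} (close pu) ⟩
          2 * Δ G part i                   ≤⟨ *-monoʳ-≤ 2 (≤ᵇ⇒≤ (Δ G part i) (4 * localCost G c u) (subst T (sym h) _)) ⟩
          2 * (4 * localCost G c u)        ≡⟨ *-assoc 2 4 (localCost G c u) ⟨
          8 * localCost G c u              ∎

    cost-A≤ : cost G (clusteringA G part) ≤ 2 * ∑[ u < n ] sparseDegree u + 17 * ∑[ u < n ] localCost G c u
    cost-A≤ = begin
      cost G (clusteringA G part)                              ≤⟨ cost≤∑localCost G (clusteringA G part) ⟩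
      ∑[ u < n ] ∑[ v < n ] edgeCost G (clusteringA G part) u v ≤⟨ sum-mono-≤ (λ u → sum-mono-≤ (edgeCost-A≤charge u)) ⟩
      ∑[ u < n ] ∑[ v < n ] charge u v                         ≡⟨ ∑∑-symmetrise oneSidedCharge (edgeCost G c) ⟩
      O + O + D                                                ≤⟨ +-monoˡ-≤ D (+-mono-≤ O≤ O≤) ⟩
      (S + 8 * D) + (S + 8 * D) + D                            ≡⟨ collect S D ⟩
      2 * S + 17 * D                                           ∎
      where
      open ≤-Reasoning
      S = ∑[ u < n ] sparseDegree u
      D = ∑[ u < n ] localCost G c u
      O = ∑[ u < n ] ∑[ v < n ] oneSidedCharge u v
      O≤ : O ≤ S + 8 * D
      O≤ = begin
        ∑[ u < n ] ∑[ v < n ] oneSidedCharge u v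
          ≡⟨ sum-cong-≗ (λ u → ∑-distrib-+ (sparseCharge u) (denseCharge (part u) u)) ⟩
        ∑[ u < n ] (∑[ v < n ] sparseCharge u v + ∑[ v < n ] denseCharge (part u) u v)
          ≤⟨ sum-mono-≤ (λ u → +-mono-≤ (≤-reflexive (∑sparseCharge≡ u)) (∑denseCharge≤ u)) ⟩
        ∑[ u < n ] (sparseDegree u + 8 * localCost G c u)
          ≡⟨ ∑-distrib-+ sparseDegree (λ u → 8 * localCost G c u) ⟩
        S + ∑[ u < n ] (8 * localCost G c u)
          ≡⟨ cong (S +_) (*-distribˡ-sum 8 (localCost G c)) ⟨
        S + 8 * D ∎
      collect : ∀ S D → (S + 8 * D) + (S + 8 * D) + D ≡ 2 * S + 17 * D
      collect = solve-∀

  -- The hypotheses of an ε-sparse-dense decomposition with ε = e / f and η₀ ε = P / Q, denominators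
  -- cleared.
  record IsScaledSparseDense {n k : ℕ} (G : LabeledGraph n) (part : Fin n → Maybe (Fin k)) (e f P Q : ℕ) : Set where
    field
      sparseCond : ∀ v → part v ≡ nothing →
        Σ (Subset n) λ S → (S ⊆ N⁺ G v) × (P * deg⁺ G v ≤ Q * ∣ S ∣) ×
          (∀ u → u ∈ S → P * (deg⁺ G u ⊔ deg⁺ G v) ≤ Q * ∣ N⁺ G u △ N⁺ G v ∣)
      sizeLower : ∀ i → f * Δ G part i ≤ f * ∣ Kset G part i ∣ + e * Δ G part i
      nonNbrsInside : ∀ i v → part v ≡ just i → f * ∣ Kset G part i ─ N⁺ G v ∣ ≤ e * Δ G part i
      nbrsOutside : ∀ i v → part v ≡ just i → f * ∣ N⁺ G v ─ Kset G part i ∣ ≤ e * Δ G part i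

  module _ {n k : ℕ} {G : LabeledGraph n} {part : Fin n → Maybe (Fin k)} {e f P Q : ℕ}
           (sd : IsScaledSparseDense G part e f P Q) where

    open IsScaledSparseDense sd

    close : ∀ {i u} → part u ≡ just i → f * ∣ Kset G part i △ N⁺ G u ∣ ≤ 2 * (e * Δ G part i)
    close {i} {u} pu = begin
      f * ∣ Kset G part i △ N⁺ G u ∣                                ≤⟨ *-monoʳ-≤ f (∣p∪q∣≤∣p∣+∣q∣ (Kset G part i ─ N⁺ G u) (N⁺ G u ─ Kset G part i)) ⟩
      f * (∣ Kset G part i ─ N⁺ G u ∣ + ∣ N⁺ G u ─ Kset G part i ∣)  ≡⟨ *-distribˡ-+ f _ _ ⟩
      f * ∣ Kset G part i ─ N⁺ G u ∣ + f * ∣ N⁺ G u ─ Kset G part i ∣ ≤⟨ +-mono-≤ (nonNbrsInside i u pu) (nbrsOutside i u pu) ⟩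
      e * Δ G part i + e * Δ G part i                                ≡⟨ cong (e * Δ G part i +_) (+-identityʳ _) ⟨
      2 * (e * Δ G part i)                                           ∎
      where open ≤-Reasoning

    scaled-approximation : .{{_ : NonZero f}} → 10 * e ≤ f → (c : Clustering n) →
      P * P * cost G (clusteringA G part) ≤ (2 * (Q * (P + 4 * Q)) + 17 * (P * P)) * (2 * cost G c)
    scaled-approximation 10e≤f c = begin
      P * P * cost G (clusteringA G part)    ≤⟨ *-monoʳ-≤ (P * P) cost-A≤ ⟩
      P * P * (2 * S + 17 * D)               ≡⟨ expand P S D ⟩
      2 * (P * P * S) + 17 * (P * P) * D     ≤⟨ +-monoˡ-≤ (17 * (P * P) * D) (*-monoʳ-≤ 2 sparse-bound) ⟩
      2 * (Q * (P + 4 * Q) * D) + 17 * (P * P) * D ≡⟨ collect P Q D ⟩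
      (2 * (Q * (P + 4 * Q)) + 17 * (P * P)) * D   ≤⟨ *-monoʳ-≤ (2 * (Q * (P + 4 * Q)) + 17 * (P * P)) (∑localCost≤2*cost G c) ⟩
      (2 * (Q * (P + 4 * Q)) + 17 * (P * P)) * (2 * cost G c) ∎
      where
      open ≤-Reasoning
      open Charging G part c {e} 10e≤f sizeLower close
      open SparseVertices G c P Q
      S = ∑[ u < n ] sparseDegree u
      D = ∑[ u < n ] localCost G c u
      weight-bound : ∀ u → P * sparseDegree u ≤ Q * sparseWeight u
      weight-bound u = by-part (part u) refl
        where
        by-part : ∀ o → part u ≡ o → P * ([ is-nothing o ] * deg⁺ G u) ≤ Q * sparseWeight u
        by-part (just _) _  = ≤-trans (≤-reflexive (*-zeroʳ P)) z≤n
        by-part nothing  pu with sparseCond u pu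
        ... | Sᵤ , Sᵤ⊆N⁺ , degree-bound , dissimilar =
          ≤-trans (≤-reflexive (cong (P *_) (*-identityˡ (deg⁺ G u)))) (sparse-vertex-bound Sᵤ Sᵤ⊆N⁺ degree-bound dissimilar)
      sparse-bound : P * P * S ≤ Q * (P + 4 * Q) * D
      sparse-bound = sparse-degrees-bound sparseDegree weight-bound
      expand : ∀ P S D → P * P * (2 * S + 17 * D) ≡ 2 * (P * P * S) + 17 * (P * P) * D
      expand = solve-∀
      collect : ∀ P Q D → 2 * (Q * (P + 4 * Q) * D) + 17 * (P * P) * D ≡ (2 * (Q * (P + 4 * Q)) + 17 * (P * P)) * D
      collect = solve-∀

  approximationFactor : ℕ → ℕ → ℕ
  approximationFactor a b = 2 * (2 * (b * (a + 4 * b)) + 17 * (a * a))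

  approximationFactor-bound : ∀ {a b e f X D} → e ≤ f →
    a * e * (a * e) * X ≤ (2 * (b * f * (a * e + 4 * (b * f))) + 17 * (a * e * (a * e))) * (2 * D) →
    e * e * (a * a) * X ≤ approximationFactor a b * (f * f) * D
  approximationFactor-bound {a} {b} {e} {f} {X} {D} e≤f bound = begin
    e * e * (a * a) * X                                                        ≡⟨ regroup a e X ⟩
    a * e * (a * e) * X                                                        ≤⟨ bound ⟩
    (2 * (b * f * (a * e + 4 * (b * f))) + 17 * (a * e * (a * e))) * (2 * D)
      ≤⟨ *-monoˡ-≤ (2 * D) (+-mono-≤ (*-monoʳ-≤ 2 (*-monoʳ-≤ (b * f) (+-monoˡ-≤ (4 * (b * f)) ae≤af)))
                                     (*-monoʳ-≤ 17 (*-mono-≤ ae≤af ae≤af))) ⟩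
    (2 * (b * f * (a * f + 4 * (b * f))) + 17 * (a * f * (a * f))) * (2 * D)   ≡⟨ factor a b f D ⟩
    approximationFactor a b * (f * f) * D                                      ∎
    where
    open ≤-Reasoning
    ae≤af : a * e ≤ a * f
    ae≤af = *-monoʳ-≤ a e≤f
    regroup : ∀ a e X → e * e * (a * a) * X ≡ a * e * (a * e) * X
    regroup = solve-∀
    factor : ∀ a b f D → (2 * (b * f * (a * f + 4 * (b * f))) + 17 * (a * f * (a * f))) * (2 * D) ≡
                         2 * (2 * (b * (a + 4 * b)) + 17 * (a * a)) * (f * f) * D
    factor = solve-∀

module Scaling where

  open import Data.Fin using (Fin)
  open import Data.Maybe using (Maybe)
  open import Data.Nat as ℕ using (ℕ; suc)
  import Data.Nat.Properties as ℕ
  open import Data.Integer as ℤ using (+_; -[1+_])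
  import Data.Integer.Properties as ℤ
  open import Data.Product using (_,_)
  open import Data.Rational
  open import Data.Rational.Properties
  import Data.Rational.Unnormalised as ℚᵘ
  import Data.Rational.Unnormalised.Properties as ℚᵘ
  open import Data.Rational.Solver using (module +-*-Solver)
  open import Relation.Binary.PropositionalEquality
  open Combinatorics using (IsScaledSparseDense)

  toℚᵘ-⟦⟧ : ∀ m → toℚᵘ ⟦ m ⟧ ℚᵘ.≃ ℚᵘ.mkℚᵘ (+ m) 0
  toℚᵘ-⟦⟧ m = toℚᵘ-fromℚᵘ (ℚᵘ.mkℚᵘ (+ m) 0)

  ⟦⟧-* : ∀ m n → ⟦ m ℕ.* n ⟧ ≡ ⟦ m ⟧ * ⟦ n ⟧
  ⟦⟧-* m n = toℚᵘ-injective (begin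
      toℚᵘ ⟦ m ℕ.* n ⟧                       ≈⟨ toℚᵘ-⟦⟧ (m ℕ.* n) ⟩
      ℚᵘ.mkℚᵘ (+ (m ℕ.* n)) 0                ≡⟨ cong (λ z → ℚᵘ.mkℚᵘ z 0) (ℤ.pos-* m n) ⟩
      ℚᵘ.mkℚᵘ (+ m) 0 ℚᵘ.* ℚᵘ.mkℚᵘ (+ n) 0  ≈⟨ ℚᵘ.*-cong (toℚᵘ-⟦⟧ m) (toℚᵘ-⟦⟧ n) ⟨
      toℚᵘ ⟦ m ⟧ ℚᵘ.* toℚᵘ ⟦ n ⟧             ≈⟨ toℚᵘ-homo-* ⟦ m ⟧ ⟦ n ⟧ ⟨
      toℚᵘ (⟦ m ⟧ * ⟦ n ⟧)                   ∎)
    where open ℚᵘ.≃-Reasoning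

  ⟦⟧-+ : ∀ m n → ⟦ m ℕ.+ n ⟧ ≡ ⟦ m ⟧ + ⟦ n ⟧
  ⟦⟧-+ m n = toℚᵘ-injective (begin
      toℚᵘ ⟦ m ℕ.+ n ⟧                       ≈⟨ toℚᵘ-⟦⟧ (m ℕ.+ n) ⟩
      ℚᵘ.mkℚᵘ (+ (m ℕ.+ n)) 0                ≈⟨ ℚᵘ.*≡* (cong (ℤ._* + 1) (trans (ℤ.pos-+ m n)
                                                   (cong₂ ℤ._+_ (sym (ℤ.*-identityʳ (+ m))) (sym (ℤ.*-identityʳ (+ n)))))) ⟩
      ℚᵘ.mkℚᵘ (+ m) 0 ℚᵘ.+ ℚᵘ.mkℚᵘ (+ n) 0  ≈⟨ ℚᵘ.+-cong (toℚᵘ-⟦⟧ m) (toℚᵘ-⟦⟧ n) ⟨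
      toℚᵘ ⟦ m ⟧ ℚᵘ.+ toℚᵘ ⟦ n ⟧             ≈⟨ toℚᵘ-homo-+ ⟦ m ⟧ ⟦ n ⟧ ⟨
      toℚᵘ (⟦ m ⟧ + ⟦ n ⟧)                   ∎)
    where open ℚᵘ.≃-Reasoning

  ⟦⟧-cancel-≤ : ∀ {m n} → ⟦ m ⟧ ≤ ⟦ n ⟧ → m ℕ.≤ n
  ⟦⟧-cancel-≤ {m} {n} ⟦m⟧≤⟦n⟧ with ℚᵘ.≤-respʳ-≃ (toℚᵘ-⟦⟧ n) (ℚᵘ.≤-respˡ-≃ (toℚᵘ-⟦⟧ m) (toℚᵘ-mono-≤ ⟦m⟧≤⟦n⟧))
  ... | ℚᵘ.*≤* m≤n = ℤ.drop‿+≤+ (subst₂ ℤ._≤_ (ℤ.*-identityʳ (+ m)) (ℤ.*-identityʳ (+ n)) m≤n)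

  ⟦⟧-mono-≤ : ∀ {m n} → m ℕ.≤ n → ⟦ m ⟧ ≤ ⟦ n ⟧
  ⟦⟧-mono-≤ {m} {n} m≤n = toℚᵘ-cancel-≤ (ℚᵘ.≤-respʳ-≃ (ℚᵘ.≃-sym (toℚᵘ-⟦⟧ n)) (ℚᵘ.≤-respˡ-≃ (ℚᵘ.≃-sym (toℚᵘ-⟦⟧ m))
    (ℚᵘ.*≤* (subst₂ ℤ._≤_ (sym (ℤ.*-identityʳ (+ m))) (sym (ℤ.*-identityʳ (+ n))) (ℤ.+≤+ m≤n)))))

  record IsFraction (q : ℚ) (m d : ℕ) : Set where
    constructor isFraction
    field
      *-denominator : q * ⟦ d ⟧ ≡ ⟦ m ⟧

  /-isFraction : ∀ m d .{{_ : ℕ.NonZero d}} → IsFraction (+ m / d) m d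
  /-isFraction m (suc d) = isFraction (toℚᵘ-injective (begin
      toℚᵘ (+ m / suc d * ⟦ suc d ⟧)                ≈⟨ toℚᵘ-homo-* (+ m / suc d) ⟦ suc d ⟧ ⟩
      toℚᵘ (+ m / suc d) ℚᵘ.* toℚᵘ ⟦ suc d ⟧         ≈⟨ ℚᵘ.*-cong (toℚᵘ-fromℚᵘ (ℚᵘ.mkℚᵘ (+ m) d)) (toℚᵘ-⟦⟧ (suc d)) ⟩
      ℚᵘ.mkℚᵘ (+ m) d ℚᵘ.* ℚᵘ.mkℚᵘ (+ suc d) 0      ≈⟨ ℚᵘ.*≡* (trans (ℤ.*-identityʳ _) (cong (λ k → + m ℤ.* + suc k) (sym (ℕ.*-identityʳ d)))) ⟩
      ℚᵘ.mkℚᵘ (+ m) 0                                ≈⟨ toℚᵘ-⟦⟧ m ⟨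
      toℚᵘ ⟦ m ⟧                                     ∎))
    where open ℚᵘ.≃-Reasoning

  nonNeg-isFraction : ∀ q → 0ℚ ≤ q → IsFraction q ℤ.∣ ↥ q ∣ (↧ₙ q)
  nonNeg-isFraction q@(mkℚ (+ m) d _) _ = subst (λ r → IsFraction r m (suc d)) (↥p/↧p≡p q) (/-isFraction m (suc d))
  nonNeg-isFraction (mkℚ -[1+ _ ] _ _) (*≤* ())

  ⟦⟧-nonNeg : ∀ m → NonNegative ⟦ m ⟧
  ⟦⟧-nonNeg m = normalize-nonNeg m 1

  isFraction-* : ∀ {q r m d m′ d′} → IsFraction q m d → IsFraction r m′ d′ → IsFraction (q * r) (m ℕ.* m′) (d ℕ.* d′)
  isFraction-* {q} {r} {m} {d} {m′} {d′} (isFraction q≡m/d) (isFraction r≡m′/d′) = isFraction (begin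
    q * r * ⟦ d ℕ.* d′ ⟧          ≡⟨ cong (q * r *_) (⟦⟧-* d d′) ⟩
    q * r * (⟦ d ⟧ * ⟦ d′ ⟧)      ≡⟨ solve 4 (λ Q R D D′ → Q :* R :* (D :* D′) := Q :* D :* (R :* D′)) refl q r ⟦ d ⟧ ⟦ d′ ⟧ ⟩
    q * ⟦ d ⟧ * (r * ⟦ d′ ⟧)      ≡⟨ cong₂ _*_ q≡m/d r≡m′/d′ ⟩
    ⟦ m ⟧ * ⟦ m′ ⟧                ≡⟨ ⟦⟧-* m m′ ⟨
    ⟦ m ℕ.* m′ ⟧                  ∎)
    where
    open ≡-Reasoning
    open +-*-Solver using (solve; _:*_; _:=_)

  module _ {q : ℚ} {m d : ℕ} (q≡m/d : IsFraction q m d) where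
    open IsFraction q≡m/d
    open ≤-Reasoning
    open +-*-Solver using (solve; _:+_; _:*_; _:=_)

    clear-denominator : ∀ {x y z} → ⟦ x ⟧ ≤ ⟦ z ⟧ + q * ⟦ y ⟧ → d ℕ.* x ℕ.≤ d ℕ.* z ℕ.+ m ℕ.* y
    clear-denominator {x} {y} {z} x≤z+qy = ⟦⟧-cancel-≤ (begin
      ⟦ d ℕ.* x ⟧                          ≡⟨ ⟦⟧-* d x ⟩
      ⟦ d ⟧ * ⟦ x ⟧                        ≤⟨ *-monoˡ-≤-nonNeg ⟦ d ⟧ {{⟦⟧-nonNeg d}} x≤z+qy ⟩
      ⟦ d ⟧ * (⟦ z ⟧ + q * ⟦ y ⟧)          ≡⟨ solve 4 (λ D Z Q Y → D :* (Z :+ Q :* Y) := D :* Z :+ Q :* D :* Y) refl ⟦ d ⟧ ⟦ z ⟧ q ⟦ y ⟧ ⟩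
      ⟦ d ⟧ * ⟦ z ⟧ + q * ⟦ d ⟧ * ⟦ y ⟧    ≡⟨ cong (λ r → ⟦ d ⟧ * ⟦ z ⟧ + r * ⟦ y ⟧) *-denominator ⟩
      ⟦ d ⟧ * ⟦ z ⟧ + ⟦ m ⟧ * ⟦ y ⟧        ≡⟨ cong₂ _+_ (⟦⟧-* d z) (⟦⟧-* m y) ⟨
      ⟦ d ℕ.* z ⟧ + ⟦ m ℕ.* y ⟧            ≡⟨ ⟦⟧-+ (d ℕ.* z) (m ℕ.* y) ⟨
      ⟦ d ℕ.* z ℕ.+ m ℕ.* y ⟧              ∎)

    clear-denominatorʳ : ∀ {x y} → ⟦ x ⟧ ≤ q * ⟦ y ⟧ → d ℕ.* x ℕ.≤ m ℕ.* y
    clear-denominatorʳ {x} {y} x≤qy = subst (λ t → d ℕ.* x ℕ.≤ t ℕ.+ m ℕ.* y) (ℕ.*-zeroʳ d)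
      (clear-denominator {z = 0} (subst (⟦ x ⟧ ≤_) (sym (+-identityˡ (q * ⟦ y ⟧))) x≤qy))

    clear-denominatorˡ : ∀ {x y} → q * ⟦ x ⟧ ≤ ⟦ y ⟧ → m ℕ.* x ℕ.≤ d ℕ.* y
    clear-denominatorˡ {x} {y} qx≤y = ⟦⟧-cancel-≤ (begin
      ⟦ m ℕ.* x ⟧            ≡⟨ ⟦⟧-* m x ⟩
      ⟦ m ⟧ * ⟦ x ⟧          ≡⟨ cong (_* ⟦ x ⟧) *-denominator ⟨
      q * ⟦ d ⟧ * ⟦ x ⟧      ≡⟨ solve 3 (λ Q D X → Q :* D :* X := D :* (Q :* X)) refl q ⟦ d ⟧ ⟦ x ⟧ ⟩
      ⟦ d ⟧ * (q * ⟦ x ⟧)    ≤⟨ *-monoˡ-≤-nonNeg ⟦ d ⟧ {{⟦⟧-nonNeg d}} qx≤y ⟩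
      ⟦ d ⟧ * ⟦ y ⟧          ≡⟨ ⟦⟧-* d y ⟨
      ⟦ d ℕ.* y ⟧            ∎)

  cross-multiply : ∀ {q r m d m′ d′ x y} .{{_ : ℕ.NonZero d}} .{{_ : ℕ.NonZero d′}} →
    IsFraction q m d → IsFraction r m′ d′ → m ℕ.* d′ ℕ.* x ℕ.≤ m′ ℕ.* d ℕ.* y → q * ⟦ x ⟧ ≤ r * ⟦ y ⟧
  cross-multiply {q} {r} {m} {d} {m′} {d′} {x} {y} (isFraction q≡m/d) (isFraction r≡m′/d′) mdx≤mdy =
    *-cancelʳ-≤-pos ⟦ d ℕ.* d′ ⟧ {{normalize-pos (d ℕ.* d′) 1 {{_}} {{ℕ.m*n≢0 d d′}}}} (begin
      q * ⟦ x ⟧ * ⟦ d ℕ.* d′ ⟧               ≡⟨ cong (q * ⟦ x ⟧ *_) (⟦⟧-* d d′) ⟩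
      q * ⟦ x ⟧ * (⟦ d ⟧ * ⟦ d′ ⟧)           ≡⟨ solve 4 (λ Q X D D′ → Q :* X :* (D :* D′) := Q :* D :* D′ :* X) refl q ⟦ x ⟧ ⟦ d ⟧ ⟦ d′ ⟧ ⟩
      q * ⟦ d ⟧ * ⟦ d′ ⟧ * ⟦ x ⟧             ≡⟨ cong (λ t → t * ⟦ d′ ⟧ * ⟦ x ⟧) q≡m/d ⟩
      ⟦ m ⟧ * ⟦ d′ ⟧ * ⟦ x ⟧                 ≡⟨ trans (⟦⟧-* (m ℕ.* d′) x) (cong (_* ⟦ x ⟧) (⟦⟧-* m d′)) ⟨
      ⟦ m ℕ.* d′ ℕ.* x ⟧                     ≤⟨ ⟦⟧-mono-≤ mdx≤mdy ⟩
      ⟦ m′ ℕ.* d ℕ.* y ⟧                     ≡⟨ trans (⟦⟧-* (m′ ℕ.* d) y) (cong (_* ⟦ y ⟧) (⟦⟧-* m′ d)) ⟩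
      ⟦ m′ ⟧ * ⟦ d ⟧ * ⟦ y ⟧                 ≡⟨ cong (λ t → t * ⟦ d ⟧ * ⟦ y ⟧) r≡m′/d′ ⟨
      r * ⟦ d′ ⟧ * ⟦ d ⟧ * ⟦ y ⟧             ≡⟨ solve 4 (λ R D′ D Y → R :* D′ :* D :* Y := R :* Y :* (D :* D′)) refl r ⟦ d′ ⟧ ⟦ d ⟧ ⟦ y ⟧ ⟩
      r * ⟦ y ⟧ * (⟦ d ⟧ * ⟦ d′ ⟧)           ≡⟨ cong (r * ⟦ y ⟧ *_) (⟦⟧-* d d′) ⟨
      r * ⟦ y ⟧ * ⟦ d ℕ.* d′ ⟧               ∎)
    where
    open ≤-Reasoning
    open +-*-Solver using (solve; _:*_; _:=_)

  sparseDense⇒scaled : ∀ {n k} {G : LabeledGraph n} {part : Fin n → Maybe (Fin k)} {η₀ ε : ℚ} {e f P Q : ℕ} →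
    IsFraction ε e f → IsFraction (η₀ * ε) P Q → IsSparseDense G part η₀ ε → IsScaledSparseDense G part e f P Q
  sparseDense⇒scaled {G = G} {part} {η₀} {ε} ε≡e/f η₀ε≡P/Q sd = record
    { sparseCond    = λ v pv → let S , S⊆N⁺ , degree-bound , dissimilar = sparseCond v pv in
                      S , S⊆N⁺ , clear-denominatorˡ η₀ε≡P/Q degree-bound , λ u u∈S → clear-denominatorˡ η₀ε≡P/Q (dissimilar u u∈S)
    ; sizeLower     = λ i → clear-denominator ε≡e/f (shift (sizeLower i))
    ; nonNbrsInside = λ i v pv → clear-denominatorʳ ε≡e/f (nonNbrsInside i v pv)
    ; nbrsOutside   = λ i v pv → clear-denominatorʳ ε≡e/f (nbrsOutside i v pv)
    }
    where
    open IsSparseDense sd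
    shift : ∀ {x y} → (⟦ 1 ⟧ - ε) * x ≤ y → x ≤ y + ε * x
    shift {x} {y} h = begin
      x                             ≡⟨ solve 2 (λ E X → X := (con 1ℚ :- E) :* X :+ E :* X) refl ε x ⟩
      (⟦ 1 ⟧ - ε) * x + ε * x       ≤⟨ +-monoˡ-≤ (ε * x) h ⟩
      y + ε * x                     ∎
      where
      open ≤-Reasoning
      open +-*-Solver using (solve; con; _:+_; _:-_; _:*_; _:=_)

  ε₀ : ℚ
  ε₀ = + 1 / 10

  ε≤ε₀⇒10e≤f : ∀ {ε e f} → IsFraction ε e f → ε ≤ ε₀ → 10 ℕ.* e ℕ.≤ f
  ε≤ε₀⇒10e≤f {ε} {e} {f} (isFraction ε*f≡e) ε≤ε₀ =
    subst (10 ℕ.* e ℕ.≤_) (ℕ.*-identityˡ f) (clear-denominatorʳ (/-isFraction 1 10) {e} e≤ε₀f)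
    where
    e≤ε₀f : ⟦ e ⟧ ≤ ε₀ * ⟦ f ⟧
    e≤ε₀f = subst (_≤ ε₀ * ⟦ f ⟧) ε*f≡e (*-monoʳ-≤-nonNeg ⟦ f ⟧ {{⟦⟧-nonNeg f}} ε≤ε₀)

open import Data.Fin using (Fin)
open import Data.Integer as ℤ using (+_)
open import Data.Maybe using (Maybe)
open import Data.Nat as ℕ using (ℕ)
import Data.Nat.Properties as ℕ
open import Data.Product using (Σ; _×_; _,_)
open import Data.Rational using (ℚ; 0ℚ; _<_; _≤_; _*_; _/_; ↥_; ↧ₙ_; *<*; positive)
open import Data.Rational.Properties using (<⇒≤; pos⇒nonZero)
open Combinatorics using (scaled-approximation; approximationFactor; approximationFactor-bound)
open Scaling

theorem4p1 : (η₀ : ℚ) → 0ℚ < η₀ →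
  Σ ℚ λ ε₀ → (0ℚ < ε₀) × Σ ℚ λ C →
    (ε : ℚ) → 0ℚ < ε → ε ≤ ε₀ →
    (n : ℕ) (G : LabeledGraph n) (k : ℕ) (part : Fin n → Maybe (Fin k)) →
    IsSparseDense G part η₀ ε →
    (c : Clustering n) →
    ε * ε * ⟦ cost G (clusteringA G part) ⟧ ≤ C * ⟦ cost G c ⟧
-- Matching η₀ against its record constructor lets toℚᵘ η₀ compute, as the NonZero instance requires.
theorem4p1 η₀@record{} 0<η₀ = ε₀ , *<* (ℤ.+<+ (ℕ.s≤s ℕ.z≤n)) , C , approximation
  where
  a = ℤ.∣ ↥ η₀ ∣
  b = ↧ₙ η₀
  instance
    a≢0 : ℕ.NonZero a
    a≢0 = pos⇒nonZero η₀ {{positive 0<η₀}}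
  C : ℚ
  C = (+ approximationFactor a b / (a ℕ.* a)) {{ℕ.m*n≢0 a a}}
  approximation : (ε : ℚ) → 0ℚ < ε → ε ≤ ε₀ → (n : ℕ) (G : LabeledGraph n) (k : ℕ) (part : Fin n → Maybe (Fin k)) →
    IsSparseDense G part η₀ ε → (c : Clustering n) → ε * ε * ⟦ cost G (clusteringA G part) ⟧ ≤ C * ⟦ cost G c ⟧
  approximation ε 0<ε ε≤ε₀ n G k part sd c =
    cross-multiply {{_}} {{ℕ.m*n≢0 a a}} (isFraction-* ε≡e/f ε≡e/f) (/-isFraction (approximationFactor a b) (a ℕ.* a) {{ℕ.m*n≢0 a a}})
      (approximationFactor-bound {a} {b} {e} {f} {cost G (clusteringA G part)} {cost G c} (ℕ.≤-trans (ℕ.m≤n*m e 10) 10e≤f)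
        (scaled-approximation (sparseDense⇒scaled ε≡e/f (isFraction-* η₀≡a/b ε≡e/f) sd) 10e≤f c))
    where
    e = ℤ.∣ ↥ ε ∣
    f = ↧ₙ ε
    ε≡e/f = nonNeg-isFraction ε (<⇒≤ 0<ε)
    η₀≡a/b = nonNeg-isFraction η₀ (<⇒≤ 0<η₀)
    10e≤f = ε≤ε₀⇒10e≤f ε≡e/f ε≤ε₀
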